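{- Let $v\geq 7$ and let $C_v$ be the configuration with point set $\mathbb{Z}_v$ and blocks $\{i,i+1,i+3\}$ for $i\in\mathbb{Z}_v$. If $v=4a+5b$ for some non-negative integers $a,b$, then $\chi_s(C_v)\leq 5$.
   Context: A strong colouring of a configuration is an assignment of colours to points such that the three points of every block receive three distinct colours; the strong chromatic number $\chi_s$ is the minimum number of colours in a strong colouring. -}

module Defs where

open import Data.Nat using (ℕ; suc; _+_; NonZero)
open import Data.Nat.DivMod using (_mod_)
open import Data.Fin using (Fin; toℕ)
open import Data.Product using (Σ; _×_; _,_)
open import Relation.Binary.PropositionalEquality using (_≢_)

record Configuration : Set₁ where
  field
    nPoints : ℕ
    Block   : Set
    block   : Block → Fin nPoints × Fin nPoints × Fin nPoints

open Configuration public

Distinct3 : {A : Set} → A → A → A → Set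
Distinct3 x y z = (x ≢ y) × (x ≢ z) × (y ≢ z)

IsStrongColouring : (C : Configuration) (k : ℕ) → (Fin (nPoints C) → Fin k) → Set
IsStrongColouring C k c =
  ∀ (b : Block C) → let (x , y , z) = block C b in Distinct3 (c x) (c y) (c z)

χs≤ : Configuration → ℕ → Set
χs≤ C k = Σ (Fin (nPoints C) → Fin k) (IsStrongColouring C k)

_+ᵥ_ : {v : ℕ} .{{_ : NonZero v}} → Fin v → ℕ → Fin v
_+ᵥ_ {v} i k = (toℕ i + k) mod v

C : (v : ℕ) .{{_ : NonZero v}} → Configuration
C v = record
  { nPoints = v
  ; Block   = Fin v
  ; block   = λ i → (i , i +ᵥ 1 , i +ᵥ 3)
  }

module Submission where

-- Cut ℤ_v into consecutive runs of 4 or 5 points and colour each point by its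
-- position inside its run. Read cyclically, these colours rise by one at each
-- step and drop back to 0 only after reaching at least 3; such a sawtooth
-- sequence cannot repeat a value within 3 steps, because a drop puts it at
-- least 4 below where it would otherwise be. The points of a block
-- {i, i+1, i+3} lie within 3 steps of each other, so they get distinct colours.

open import Defs
open import Data.Nat using (ℕ; _+_; _*_; _≤_)
open import Data.Nat.Base using (NonZero)
open import Data.Product using (_×_)
open import Relation.Binary.PropositionalEquality using (_≡_)

open import Data.Nat using (zero; suc; _<_; _∸_; _%_; _/_; _<?_; s≤s; z<s)
open import Data.Nat.Properties
open import Data.Nat.DivMod using (m%n<n; m%n%n≡m%n; m<n⇒m%n≡m; n%n≡0; [m+kn]%n≡m%n; m≡m%n+[m/n]*n)
open import Data.Nat.ListAction using (sum)
open import Data.Nat.ListAction.Properties using (sum-++)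
open import Data.Fin using (Fin; toℕ; fromℕ<)
open import Data.Fin.Properties using (toℕ-fromℕ<; fromℕ<-injective)
open import Data.List using (List; []; _∷_; _++_; replicate)
open import Data.List.Relation.Unary.All using (All; _∷_)
import Data.List.Relation.Unary.All.Properties as All
open import Data.Product using (_,_)
open import Data.Sum using (_⊎_; inj₁; inj₂)
open import Data.Empty using (⊥-elim)
open import Relation.Nullary using (yes; no; ¬_)
open import Relation.Binary.PropositionalEquality
  using (_≢_; refl; sym; trans; cong; cong₂; subst; module ≡-Reasoning)

SawtoothStep : ℕ → ℕ → ℕ → Set
SawtoothStep r x y = y ≡ suc x ⊎ (y ≡ 0 × r ≤ suc x)

Sawtooth : ℕ → (ℕ → ℕ) → Set
Sawtooth r o = ∀ n → SawtoothStep r (o n) (o (suc n))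

module _ {r : ℕ} {o : ℕ → ℕ} (saw : Sawtooth r o) where

  Drift : ℕ → ℕ → Set
  Drift d n = o (d + n) ≡ d + o n ⊎ r + o (d + n) ≤ d + o n

  drift⇒≤ : ∀ {d n} → Drift d n → o (d + n) ≤ d + o n
  drift⇒≤ (inj₁ e)  = ≤-reflexive e
  drift⇒≤ (inj₂ le) = m+n≤o⇒n≤o r le

  sawtooth-drift : ∀ d n → Drift d n
  sawtooth-drift zero    n = inj₁ refl
  sawtooth-drift (suc d) n with saw (d + n) | sawtooth-drift d n
  ... | inj₁ up          | inj₁ e  = inj₁ (trans up (cong suc e))
  ... | inj₁ up          | inj₂ le =
    inj₂ (subst (_≤ suc d + o n) (sym (trans (cong (r +_) up) (+-suc r _))) (s≤s le))
  ... | inj₂ (down , r≤) | ih      =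
    inj₂ (subst (_≤ suc d + o n) (sym (trans (cong (r +_) down) (+-identityʳ r)))
                (≤-trans r≤ (s≤s (drift⇒≤ ih))))

  sawtooth-≢ : ∀ n d → 0 < d → d < r → o n ≢ o (n + d)
  sawtooth-≢ n d 0<d d<r eq = no-return (trans eq (cong o (+-comm n d))) (sawtooth-drift d n)
    where
    no-return : o n ≡ o (d + n) → ¬ Drift d n
    no-return e (inj₁ up) = <-irrefl (trans e up) (+-monoˡ-< (o n) 0<d)
    no-return e (inj₂ le) = <⇒≱ d<r (+-cancelʳ-≤ (o n) r d (subst (λ t → r + t ≤ d + o n) (sym e) le))

-- Beyond sum L the junk value is 0, so the point sum L looks like the start of
-- a new run; this is what lets the runs close up around ℤ_(sum L).
offset : List ℕ → ℕ → ℕ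
offset []      m = 0
offset (ℓ ∷ L) m with m <? ℓ
... | yes _ = m
... | no  _ = offset L (m ∸ ℓ)

offset-zero : ∀ L → offset L 0 ≡ 0
offset-zero []      = refl
offset-zero (ℓ ∷ L) with 0 <? ℓ
... | yes _ = refl
... | no  _ = trans (cong (offset L) (0∸n≡0 ℓ)) (offset-zero L)

offset-sum : ∀ L → offset L (sum L) ≡ 0
offset-sum []      = refl
offset-sum (ℓ ∷ L) with ℓ + sum L <? ℓ
... | yes lt = ⊥-elim (m+n≮m ℓ (sum L) lt)
... | no  _  = trans (cong (offset L) (m+n∸m≡n ℓ (sum L))) (offset-sum L)

n≤m⇒m<n+o⇒m∸n<o : ∀ {m n o} → n ≤ m → m < n + o → m ∸ n < o
n≤m⇒m<n+o⇒m∸n<o {m} {n} {o} n≤m lt = subst (_≤ o) (+-∸-assoc 1 n≤m) (m≤n+o⇒m∸n≤o (suc m) n lt)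

offset-< : ∀ {k L m} → All (_≤ k) L → m < sum L → offset L m < k
offset-< {L = ℓ ∷ L} {m} (ℓ≤k ∷ ≤k) m<s with m <? ℓ
... | yes m<ℓ = <-≤-trans m<ℓ ℓ≤k
... | no  m≮ℓ = offset-< ≤k (n≤m⇒m<n+o⇒m∸n<o (≮⇒≥ m≮ℓ) m<s)

offset-suc : ∀ {r L m} → All (r ≤_) L → m < sum L → SawtoothStep r (offset L m) (offset L (suc m))
offset-suc {r} {ℓ ∷ L} {m} (r≤ℓ ∷ r≤) m<s with m <? ℓ | suc m <? ℓ
... | yes _   | yes _     = inj₁ refl
... | yes m<ℓ | no  m+1≮ℓ =
  inj₂ ( trans (cong (offset L) (m≤n⇒m∸n≡0 m<ℓ)) (offset-zero L)
       , subst (r ≤_) (≤-antisym (≮⇒≥ m+1≮ℓ) m<ℓ) r≤ℓ)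
... | no  m≮ℓ | yes m+1<ℓ = ⊥-elim (m≮ℓ (<-trans (n<1+n m) m+1<ℓ))
... | no  m≮ℓ | no  _     rewrite +-∸-assoc 1 (≮⇒≥ m≮ℓ) =
  offset-suc r≤ (n≤m⇒m<n+o⇒m∸n<o (≮⇒≥ m≮ℓ) m<s)

[1+m]%n≡[1+m%n]%n : ∀ m n .{{_ : NonZero n}} → suc m % n ≡ suc (m % n) % n
[1+m]%n≡[1+m%n]%n m n = begin
  suc m % n                         ≡⟨ cong (λ t → suc t % n) (m≡m%n+[m/n]*n m n) ⟩
  (suc (m % n) + (m / n) * n) % n   ≡⟨ [m+kn]%n≡m%n (suc (m % n)) (m / n) n ⟩
  suc (m % n) % n                   ∎
  where open ≡-Reasoning

module _ {L : List ℕ} .{{_ : NonZero (sum L)}} where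

  cyclicOffset : ℕ → ℕ
  cyclicOffset n = offset L (n % sum L)

  offset-suc-mod : ∀ n → offset L (suc n % sum L) ≡ offset L (suc (n % sum L))
  offset-suc-mod n with suc (n % sum L) <? sum L
  ... | yes n+1<v = cong (offset L) (trans ([1+m]%n≡[1+m%n]%n n (sum L)) (m<n⇒m%n≡m n+1<v))
  ... | no  n+1≮v = begin
    offset L (suc n % v)          ≡⟨ cong (offset L) ([1+m]%n≡[1+m%n]%n n v) ⟩
    offset L (suc (n % v) % v)    ≡⟨ cong (λ t → offset L (t % v)) n+1≡v ⟩
    offset L (v % v)              ≡⟨ cong (offset L) (n%n≡0 v) ⟩
    offset L 0                    ≡⟨ offset-zero L ⟩
    0                             ≡⟨ sym (offset-sum L) ⟩
    offset L v                    ≡⟨ cong (offset L) (sym n+1≡v) ⟩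
    offset L (suc (n % v))        ∎
    where
    open ≡-Reasoning
    v = sum L
    n+1≡v : suc (n % v) ≡ v
    n+1≡v = ≤-antisym (m%n<n n v) (≮⇒≥ n+1≮v)

  cyclicOffset-sawtooth : ∀ {r} → All (r ≤_) L → Sawtooth r cyclicOffset
  cyclicOffset-sawtooth r≤ n =
    subst (SawtoothStep _ (cyclicOffset n)) (sym (offset-suc-mod n)) (offset-suc r≤ (m%n<n n (sum L)))

χs≤-periodic : ∀ {v k} .{{_ : NonZero v}} (o : ℕ → ℕ) → (∀ n → o n < k) → (∀ n → o (n % v) ≡ o n) →
               (∀ n d → 0 < d → d < 4 → o n ≢ o (n + d)) → χs≤ (C v) k
χs≤-periodic {v} {k} o o<k periodic spread = colour , strong
  where
  colour : Fin v → Fin k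
  colour x = fromℕ< (o<k (toℕ x))

  o-shift : ∀ x d → o (toℕ (x +ᵥ d)) ≡ o (toℕ x + d)
  o-shift x d = trans (cong o (toℕ-fromℕ< (m%n<n (toℕ x + d) v))) (periodic (toℕ x + d))

  apart : ∀ {x y} n d → 0 < d → d < 4 → o (toℕ x) ≡ o n → o (toℕ y) ≡ o (n + d) → colour x ≢ colour y
  apart n d 0<d d<4 ox oy eq =
    spread n d 0<d d<4 (trans (sym ox) (trans (fromℕ<-injective _ _ (o<k _) (o<k _) eq) oy))

  strong : IsStrongColouring (C v) k colour
  strong x = apart n 1 z<s (s≤s z<s) refl (o-shift x 1)
           , apart n 3 z<s ≤-refl refl (o-shift x 3)
           , apart (n + 1) 2 z<s (s≤s (s≤s z<s)) (o-shift x 1)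
                   (trans (o-shift x 3) (cong o (sym (+-assoc n 1 2))))
    where n = toℕ x

χs≤-runs : ∀ {v k} (L : List ℕ) → v ≡ sum L → All (4 ≤_) L → All (_≤ k) L →
           .{{_ : NonZero v}} → χs≤ (C v) k
χs≤-runs L refl 4≤ ≤k =
  χs≤-periodic (cyclicOffset {L})
    (λ n → offset-< ≤k (m%n<n n (sum L)))
    (λ n → cong (offset L) (m%n%n≡m%n n (sum L)))
    (sawtooth-≢ (cyclicOffset-sawtooth {L} 4≤))

sum-replicate : ∀ n x → sum (replicate n x) ≡ n * x
sum-replicate zero    x = refl
sum-replicate (suc n) x = cong (x +_) (sum-replicate n x)

lemma22 : (v : ℕ) → 7 ≤ v → (a b : ℕ) → v ≡ 4 * a + 5 * b →
    (nz : NonZero v) → χs≤ (C v {{nz}}) 5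
lemma22 v _ a b v≡ nz = χs≤-runs runs (trans v≡ (sym sum-runs))
  (All.++⁺ (All.replicate⁺ a ≤-refl) (All.replicate⁺ b (n≤1+n 4)))
  (All.++⁺ (All.replicate⁺ a (n≤1+n 4)) (All.replicate⁺ b ≤-refl)) {{nz}}
  where
  runs : List ℕ
  runs = replicate a 4 ++ replicate b 5
  sum-runs : sum runs ≡ 4 * a + 5 * b
  sum-runs = trans (sum-++ (replicate a 4) (replicate b 5))
                   (cong₂ _+_ (trans (sum-replicate a 4) (*-comm a 4)) (trans (sum-replicate b 5) (*-comm b 5)))
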